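{- Let $n\ge1$. The map $\gamma: S_1\times S_{n-1}\to\mathrm{inc}(n)$ is a bijection. Moreover, for $T\in\mathrm{inc}(n)$, the permutation $\gamma^{ -1}(T)\in S_1\times S_{n-1}$ is the permutation such that, for $2\le i\le n$, $(\gamma^{ -1}(T))(i)$ is the label in $T$ of the $(i-1)$-th vertex visited in the postorder traversal of $\rho(T)$.
   Context: $S_1\times S_{n-1}$ denotes the set of permutations $\alpha$ of $\{1,\dots,n\}$ with $\alpha(1)=1$, in one-line notation. An inversion of $\alpha$ is a pair of positions $(i,j)$ with $i<j$ and $\alpha(i)>\alpha(j)$; the first inversion from position $i$ is the inversion $(i,j)$ with minimal $j$. $\mathrm{inc}(n)$ is the set of increasing trees on labels $1,\dots,n$: rooted trees with vertices labelled bijectively by $1,\dots,n$, root labelled $1$, labels increasing from parent to child. The first inversion tree $\gamma(\alpha)$ is the rooted tree on labels $1,\dots,n$ with root $1$ where for $i\ne1$ the parent of $i$ is $j$ if $(\alpha^{ -1}(i),\alpha^{ -1}(j))$ is the first inversion from position $\alpha^{ -1}(i)$, and is $1$ if there is no inversion from that position. For $T\in\mathrm{inc}(n)$, $\rho(T)$ is the plane tree (rooted tree with left-to-right ordered children) obtained by ordering the children of each vertex by increasing label. The postorder traversal of a plane tree visits, recursively, the subtrees rooted at the children of a vertex from left to right and then the vertex itself. -}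

module Defs where

open import Data.Nat using (ℕ; zero; suc; _≤_)
open import Data.Fin using (Fin; zero; suc; toℕ; _<_; _<?_; _≟_)
open import Data.Fin.Permutation using (Permutation′; _⟨$⟩ʳ_; _⟨$⟩ˡ_)
open import Data.List using (List; []; _∷_; [_]; _++_; concatMap; filter; map; allFin)
open import Data.Maybe using (Maybe; just; nothing)
open import Data.Product using (_×_)
open import Relation.Nullary.Decidable using (_×-dec_)
open import Relation.Binary.PropositionalEquality using (_≡_)

-- Conventions: n = suc m; the labels/positions 1,…,n are represented by
-- Fin (suc m) with 0-based shift (Fin element k stands for k+1).
-- So the root label 1 is `zero`, and the non-root labels 2,…,n are
-- `suc k` for k : Fin m.

-- S₁ × S_{n-1}: permutations fixing 1 (one-line notation: α ⟨$⟩ʳ i = α(i)).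
InS1xS : ∀ {m} → Permutation′ (suc m) → Set
InS1xS α = α ⟨$⟩ʳ zero ≡ zero

-- A rooted tree on labels 1..n with root 1, given by the parent of each
-- non-root vertex: parent k is the parent of label `suc k`.
ParentFun : ℕ → Set
ParentFun m = Fin m → Fin (suc m)

-- Increasing: every non-root vertex has parent with smaller label.
-- (Such a parent function is exactly a rooted tree with root 1 that is
--  increasing; inc(n) = increasing parent functions.)
IsIncreasing : ∀ {m} → ParentFun m → Set
IsIncreasing {m} p = ∀ (k : Fin m) → toℕ (p k) ≤ toℕ k

_≗ᵀ_ : ∀ {m} → ParentFun m → ParentFun m → Set
p ≗ᵀ q = ∀ k → p k ≡ q k

-- First inversion from position i: the least position j > i with α(j) < α(i).
-- allFin lists positions in increasing order, so the head of the filter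
-- is the minimal such j.
firstInversion : ∀ {n} → Permutation′ n → Fin n → Maybe (Fin n)
firstInversion {n} α i with filter (λ j → (i <? j) ×-dec ((α ⟨$⟩ʳ j) <? (α ⟨$⟩ʳ i))) (allFin n)
... | []    = nothing
... | j ∷ _ = just j

γ : ∀ {m} → Permutation′ (suc m) → ParentFun m
γ α k with firstInversion α (α ⟨$⟩ˡ suc k)
... | nothing = zero
... | just j  = α ⟨$⟩ʳ j

-- Children of vertex v in ρ(T), ordered left-to-right by increasing label.
children : ∀ {m} → ParentFun m → Fin (suc m) → List (Fin (suc m))
children {m} p v = map suc (filter (λ k → p k ≟ v) (allFin m))

-- Postorder traversal of ρ(T) from vertex v, with a fuel parameter.
-- (For an increasing tree the depth is < n, so fuel n suffices.)
postorderFrom : ∀ {m} → ParentFun m → ℕ → Fin (suc m) → List (Fin (suc m))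
postorderFrom p zero    v = [ v ]
postorderFrom p (suc f) v = concatMap (postorderFrom p f) (children p v) ++ [ v ]

postorder : ∀ {m} → ParentFun m → List (Fin (suc m))
postorder {m} p = postorderFrom p (suc m) zero

{-# OPTIONS --safe #-}
-- Read α ∈ S₁ × S_{n-1} as the word w(α) = α(2) ⋯ α(n) α(1), which ends with the root label 1.
-- Since α(1) = 1 is the least letter, the parent of i ≠ 1 in γ(α) is the first letter after i
-- in w(α) that is smaller than i.  The postorder traversal of an increasing tree T has the same
-- property with respect to T: a vertex c is followed by the subtrees of its later siblings,
-- whose labels all exceed c, and then by its parent.  Finally, a word without repetitions is
-- determined by its set of letters and this first-smaller-successor map: the largest letter
-- sits immediately before its image, and deleting it changes no other value, so induction on
-- the length applies.  Hence γ(α) = T exactly when w(α) is the postorder traversal of T.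
module Submission where

open import Defs
open import Data.Empty using (⊥-elim)
open import Data.Fin as Fin using (Fin; zero; suc; toℕ; _<_; _≤_; _<?_; _≟_)
import Data.Fin.Properties as Fin
open import Data.Fin.Permutation
  using ( Permutation; Permutation′; _⟨$⟩ʳ_; _⟨$⟩ˡ_; permutation; inverseˡ; inverseʳ
        ; flip; _∘ₚ_; cast-id; ↔⇒≡ )
open import Data.List
  using (List; []; _∷_; [_]; _++_; map; filter; concatMap; head; allFin; tabulate; lookup; length; take)
open import Data.List.Properties
  using ( ∷-injective; ∷-injectiveˡ; ∷-injectiveʳ; ∷ʳ-injectiveʳ; ++-assoc; ++-identityʳ; ++-conicalʳ
        ; length-++-sucʳ; length-map; length-tabulate; map-++; map-tabulate; tabulate-cong; tabulate-lookup
        ; filter-++; filter-all; filter-none; filter-accept; filter-reject )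
open import Data.List.Membership.Propositional using (_∈_; _∉_; find)
open import Data.List.Membership.Propositional.Properties
  using ( ∈-++⁺ˡ; ∈-++⁺ʳ; ∈-++⁻; ∈-insert; ∈-∃++; ∈-map⁺; ∈-map⁻; ∈-filter⁺; ∈-filter⁻
        ; ∈-lookup; ∈-allFin; ∈-tabulate⁺; ∈-tabulate⁻; ∈-concat⁺′; ∈-concatMap⁺; ∈-concatMap⁻ )
open import Data.List.Relation.Binary.Subset.Propositional using (_⊆_)
open import Data.List.Relation.Binary.Subset.Propositional.Properties as ⊆ using (⊆[]⇒≡[]; xs⊆x∷xs)
open import Data.List.Relation.Unary.All as All using (All; []; _∷_)
import Data.List.Relation.Unary.All.Properties as All
open import Data.List.Relation.Unary.AllPairs as AllPairs using (AllPairs; []; _∷_)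
import Data.List.Relation.Unary.AllPairs.Properties as AllPairs
open import Data.List.Relation.Unary.Any as Any using (here; there; index)
open import Data.List.Relation.Unary.Any.Properties using (lookup-index)
open import Data.List.Relation.Unary.Unique.Propositional using (Unique)
open import Data.List.Relation.Unary.Unique.Propositional.Properties using (++⁺; map⁺; tabulate⁺)
open import Data.Maybe as Maybe using (Maybe; just; nothing; _<∣>_; maybe′)
open import Data.Maybe.Properties using (just-injective)
open import Data.Nat as ℕ using (ℕ; zero; suc; s≤s; z≤n)
import Data.Nat.Properties as ℕ
open import Data.Product using (Σ; ∃-syntax; _×_; _,_; proj₁; proj₂)
open import Data.Sum using (_⊎_; inj₁; inj₂; [_,_]′)
open import Function using (_∘_; id; case_of_)
open import Relation.Binary using (Rel)
open import Relation.Binary.PropositionalEquality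
  using (_≡_; _≢_; _≗_; refl; sym; trans; cong; cong₂; subst; module ≡-Reasoning)
open import Relation.Nullary using (¬_; yes; no)
open import Relation.Nullary.Decidable using (_×-dec_)
open import Relation.Unary using (Pred; Decidable)

module _ {a} {A : Set a} where

  head-++ : ∀ (xs : List A) {ys} → head (xs ++ ys) ≡ (head xs <∣> head ys)
  head-++ []      = refl
  head-++ (_ ∷ _) = refl

  head-∈ : ∀ {xs : List A} {x} → head xs ≡ just x → x ∈ xs
  head-∈ {_ ∷ _} refl = here refl

  take-length-++ : ∀ (xs : List A) {ys} → take (length xs) (xs ++ ys) ≡ xs
  take-length-++ []       = refl
  take-length-++ (x ∷ xs) = cong (x ∷_) (take-length-++ xs)

  tabulate-lookup-cast : ∀ (xs : List A) {k} (k≡ : k ≡ length xs) →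
    tabulate (lookup xs ∘ Fin.cast k≡) ≡ xs
  tabulate-lookup-cast xs refl =
    trans (tabulate-cong (cong (lookup xs) ∘ Fin.cast-is-id refl)) (tabulate-lookup xs)

  map-≡⇒∈-≡ : ∀ {b} {B : Set b} {f g : A → B} {xs x} →
    map f xs ≡ map g xs → x ∈ xs → f x ≡ g x
  map-≡⇒∈-≡ {xs = _ ∷ _} eq (here refl) = ∷-injectiveˡ eq
  map-≡⇒∈-≡ {xs = _ ∷ _} eq (there x∈) = map-≡⇒∈-≡ (∷-injectiveʳ eq) x∈

  head-filter-map : ∀ {b p} {B : Set b} {P : Pred B p} (f : A → B) (P? : Decidable P) xs →
    Maybe.map f (head (filter (P? ∘ f) xs)) ≡ head (filter P? (map f xs))
  head-filter-map f P? []       = refl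
  head-filter-map f P? (x ∷ xs) with P? (f x)
  ... | yes _ = refl
  ... | no _  = head-filter-map f P? xs

  filter-×-dec-All : ∀ {p q} {P : Pred A p} {Q : Pred A q} (P? : Decidable P) (Q? : Decidable Q) {xs} →
    All P xs → filter (λ x → P? x ×-dec Q? x) xs ≡ filter Q? xs
  filter-×-dec-All P? Q? []                 = refl
  filter-×-dec-All P? Q? {x ∷ _} (px ∷ pxs) with P? x | Q? x
  ... | yes _  | yes _ = cong (x ∷_) (filter-×-dec-All P? Q? pxs)
  ... | yes _  | no _  = filter-×-dec-All P? Q? pxs
  ... | no ¬px | _     = ⊥-elim (¬px px)

  maybe′-<∣>-just : ∀ {b} {B : Set b} (f : A → B) z mx →
    (Maybe.map f mx <∣> just z) ≡ just (maybe′ f z mx)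
  maybe′-<∣>-just f z nothing  = refl
  maybe′-<∣>-just f z (just _) = refl

  occurrence-in-++ : ∀ ps {qs xs} {u : A} {ys} → xs ++ u ∷ ys ≡ ps ++ qs →
    (∃[ ps′ ] ps ≡ xs ++ u ∷ ps′ × ys ≡ ps′ ++ qs) ⊎
    (∃[ qs′ ] qs ≡ qs′ ++ u ∷ ys × xs ≡ ps ++ qs′)
  occurrence-in-++ []       {xs = xs}     eq   = inj₂ (xs , sym eq , refl)
  occurrence-in-++ (_ ∷ ps) {xs = []}     refl = inj₁ (ps , refl , refl)
  occurrence-in-++ (_ ∷ ps) {xs = _ ∷ xs} eq   with refl , eq′ ← ∷-injective eq
    with occurrence-in-++ ps eq′
  ... | inj₁ (ps′ , refl , eq″) = inj₁ (ps′ , refl , eq″)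
  ... | inj₂ (qs′ , eq″ , refl) = inj₂ (qs′ , eq″ , refl)

  singleton-occurrence : ∀ {x : A} xs {u ys} → [ x ] ≡ xs ++ u ∷ ys → u ≡ x × ys ≡ []
  singleton-occurrence []       refl = refl , refl
  singleton-occurrence (_ ∷ xs) eq   with () ← ++-conicalʳ xs _ (sym (∷-injectiveʳ eq))

  sorted-split : ∀ {ℓ} {R : Rel A ℓ} {zs i} → AllPairs R zs → i ∈ zs →
    ∃[ ps ] ∃[ qs ] zs ≡ ps ++ i ∷ qs × All (λ p → R p i) ps × All (R i) qs
  sorted-split (i<qs ∷ _) (here refl) = [] , _ , refl , [] , i<qs
  sorted-split {zs = z ∷ _} (z<zs ∷ zs-sorted) (there i∈)
    with ps , qs , refl , ps<i , i<qs ← sorted-split zs-sorted i∈ =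
    z ∷ ps , qs , refl , All.lookup z<zs (∈-insert ps) ∷ ps<i , i<qs

  unique-split : ∀ {xs ys xs′ ys′ : List A} → Unique (xs ++ ys) → xs ++ ys ≡ xs′ ++ ys′ →
    head ys ≡ head ys′ → xs ≡ xs′ × ys ≡ ys′
  unique-split {[]}     {_}     {[]}      _        eq   _     = refl , eq
  unique-split {[]}     {_}     {x ∷ xs′} {[]}     _    refl ()
  unique-split {[]}     {_}     {x ∷ xs′} {_ ∷ _}  (x∉ ∷ _) refl heads =
    ⊥-elim (All.lookup x∉ (∈-insert xs′) (just-injective heads))
  unique-split {x ∷ xs} {[]}    {[]}      _        refl ()
  unique-split {x ∷ xs} {_ ∷ _} {[]}      (x∉ ∷ _) refl heads =
    ⊥-elim (All.lookup x∉ (∈-insert xs) (sym (just-injective heads)))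
  unique-split {x ∷ xs} {_}     {_ ∷ _}   (_ ∷ xs!) eq heads with refl , eq′ ← ∷-injective eq
    with xs≡ , ys≡ ← unique-split xs! eq′ heads = cong (x ∷_) xs≡ , ys≡

  unique-delete : ∀ xs {y : A} {ys} → Unique (xs ++ y ∷ ys) → Unique (xs ++ ys)
  unique-delete []       (_ ∷ ys!)  = ys!
  unique-delete (_ ∷ xs) (x∉ ∷ xs!) =
    All.++⁺ (All.++⁻ˡ xs x∉) (All.tail (All.++⁻ʳ xs x∉)) ∷ unique-delete xs xs!

  unique⇒∉-delete : ∀ xs {y : A} {ys} → Unique (xs ++ y ∷ ys) → y ∉ xs ++ ys
  unique⇒∉-delete []       (y∉ ∷ _)  y∈          = All.lookup y∉ y∈ refl
  unique⇒∉-delete (_ ∷ xs) (x∉ ∷ _)  (here refl) = All.lookup x∉ (∈-insert xs) refl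
  unique⇒∉-delete (_ ∷ xs) (_ ∷ xs!) (there y∈)  = unique⇒∉-delete xs xs! y∈

  ∈-delete : ∀ xs {x y : A} {ys} → x ∈ xs ++ y ∷ ys → x ≢ y → x ∈ xs ++ ys
  ∈-delete xs x∈ x≢y with ∈-++⁻ xs x∈
  ... | inj₁ x∈xs         = ∈-++⁺ˡ x∈xs
  ... | inj₂ (here x≡y)   = ⊥-elim (x≢y x≡y)
  ... | inj₂ (there x∈ys) = ∈-++⁺ʳ xs x∈ys

  ⊆-delete : ∀ xs {y : A} {ys xs′ ys′} → Unique (xs ++ y ∷ ys) →
    xs ++ y ∷ ys ⊆ xs′ ++ y ∷ ys′ → xs ++ ys ⊆ xs′ ++ ys′
  ⊆-delete xs {xs′ = xs′} xs! ⊆′ x∈ =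
    ∈-delete xs′ (⊆′ (⊆.++⁺ʳ xs (xs⊆x∷xs _ _) x∈)) λ { refl → unique⇒∉-delete xs xs! x∈ }

  lookup-injective : ∀ {xs : List A} → Unique xs → ∀ {i j} → lookup xs i ≡ lookup xs j → i ≡ j
  lookup-injective {_ ∷ _} _         {zero}  {zero}  _  = refl
  lookup-injective {_ ∷ _} (x∉ ∷ _)  {zero}  {suc j} eq = ⊥-elim (All.lookup x∉ (∈-lookup j) eq)
  lookup-injective {_ ∷ _} (x∉ ∷ _)  {suc i} {zero}  eq = ⊥-elim (All.lookup x∉ (∈-lookup i) (sym eq))
  lookup-injective {_ ∷ _} (_ ∷ xs!) {suc i} {suc j} eq = cong suc (lookup-injective xs! eq)

  concatMap-unique : ∀ {b} {B : Set b} {g : B → List A} {xs} → Unique xs →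
    (∀ {x} → x ∈ xs → Unique (g x)) →
    (∀ {x x′ y} → x ∈ xs → x′ ∈ xs → y ∈ g x → y ∈ g x′ → x ≡ x′) →
    Unique (concatMap g xs)
  concatMap-unique {xs = []} _ _ _ = []
  concatMap-unique {g = g} {x ∷ _} (x∉ ∷ xs!) g! disjoint =
    ++⁺ (g! (here refl))
        (concatMap-unique xs! (g! ∘ there) λ x∈ x′∈ → disjoint (there x∈) (there x′∈))
      λ (y∈gx , y∈rest) → let (x′ , x′∈ , y∈gx′) = find (∈-concatMap⁻ g y∈rest) in
        All.lookup x∉ x′∈ (disjoint (here refl) (there x′∈) y∈gx y∈gx′)

-- Permutations from enumerations

allFin-sorted : ∀ n → AllPairs _<_ (allFin n)
allFin-sorted n = AllPairs.tabulate⁺-< id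

⟨$⟩ʳ-injective : ∀ {n} (π : Permutation′ n) {i j} → π ⟨$⟩ʳ i ≡ π ⟨$⟩ʳ j → i ≡ j
⟨$⟩ʳ-injective π eq = trans (sym (inverseˡ π)) (trans (cong (π ⟨$⟩ˡ_) eq) (inverseˡ π))

enumeration↔ : ∀ {n} {xs : List (Fin n)} → Unique xs → (∀ x → x ∈ xs) → Permutation (length xs) n
enumeration↔ {xs = xs} xs! xs-all = permutation (lookup xs) (index ∘ xs-all)
  (λ x → sym (lookup-index (xs-all x)))
  (λ i → lookup-injective xs! (sym (lookup-index (xs-all (lookup xs i)))))

enumerations⇒permutation : ∀ {n} {ps xs : List (Fin n)} → Unique ps → (∀ i → i ∈ ps) →
  Unique xs → (∀ x → x ∈ xs) → Σ (Permutation′ n) λ π → map (π ⟨$⟩ʳ_) ps ≡ xs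
enumerations⇒permutation {n} {ps} {xs} ps! ps-all xs! xs-all = π , map-π
  where
  open ≡-Reasoning
  P = enumeration↔ ps! ps-all
  X = enumeration↔ xs! xs-all
  length≡ : length ps ≡ length xs
  length≡ = trans (↔⇒≡ P) (sym (↔⇒≡ X))
  π : Permutation′ n
  π = flip P ∘ₚ (cast-id length≡ ∘ₚ X)
  map-π : map (π ⟨$⟩ʳ_) ps ≡ xs
  map-π = begin
    map (π ⟨$⟩ʳ_) ps
      ≡⟨ cong (map _) (sym (tabulate-lookup ps)) ⟩
    map (π ⟨$⟩ʳ_) (tabulate (lookup ps))
      ≡⟨ map-tabulate (lookup ps) _ ⟩
    tabulate (λ i → π ⟨$⟩ʳ lookup ps i)
      ≡⟨ tabulate-cong (λ _ → cong (lookup xs ∘ Fin.cast length≡) (inverseˡ P)) ⟩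
    tabulate (lookup xs ∘ Fin.cast length≡)
      ≡⟨ tabulate-lookup-cast xs length≡ ⟩
    xs ∎

-- The first smaller successor

module _ {n : ℕ} where

  open import Data.List.Extrema (Fin.≤-totalOrder n) using (max; argmax-sel; ⊥≤max; xs≤max)

  firstBelow : Fin n → List (Fin n) → Maybe (Fin n)
  firstBelow u ys = head (filter (_<? u) ys)

  FirstBelowMap : List (Fin n) → (Fin n → Maybe (Fin n)) → Set
  FirstBelowMap L par = ∀ {xs u ys} → L ≡ xs ++ u ∷ ys → firstBelow u ys ≡ par u

  firstBelow-++ : ∀ {u} xs {ys} → firstBelow u (xs ++ ys) ≡ (firstBelow u xs <∣> firstBelow u ys)
  firstBelow-++ {u} xs {ys} = trans (cong head (filter-++ (_<? u) xs ys)) (head-++ (filter (_<? u) xs))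

  firstBelow-none : ∀ {u ys} → All (λ y → ¬ y < u) ys → firstBelow u ys ≡ nothing
  firstBelow-none {u} none = cong head (filter-none (_<? u) none)

  firstBelow-all : ∀ {u ys} → All (_< u) ys → firstBelow u ys ≡ head ys
  firstBelow-all {u} all = cong head (filter-all (_<? u) all)

  firstBelow-accept : ∀ {u t ys} → t < u → firstBelow u (t ∷ ys) ≡ just t
  firstBelow-accept {u} t<u = cong head (filter-accept (_<? u) t<u)

  firstBelow-reject : ∀ {u t ys} → ¬ t < u → firstBelow u (t ∷ ys) ≡ firstBelow u ys
  firstBelow-reject {u} t≮u = cong head (filter-reject (_<? u) t≮u)

  firstBelow-< : ∀ {u ys t} → firstBelow u ys ≡ just t → t < u
  firstBelow-< {u} {ys} eq = proj₂ (∈-filter⁻ (_<? u) {xs = ys} (head-∈ eq))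

  firstBelowMap-functional : ∀ {L p q x} → FirstBelowMap L p → FirstBelowMap L q → x ∈ L → p x ≡ q x
  firstBelowMap-functional fb fb′ x∈ with xs , ys , L≡ ← ∈-∃++ x∈ =
    trans (sym (fb {xs} {ys = ys} L≡)) (fb′ {xs} {ys = ys} L≡)

  firstBelowMap-< : ∀ {L p x t} → FirstBelowMap L p → x ∈ L → p x ≡ just t → t < x
  firstBelowMap-< fb x∈ px≡ with xs , ys , L≡ ← ∈-∃++ x∈ =
    firstBelow-< {ys = ys} (trans (fb {xs} {ys = ys} L≡) px≡)

  firstBelowMap-resp : ∀ {L p q} → p ≗ q → FirstBelowMap L p → FirstBelowMap L q
  firstBelowMap-resp p≗q fb L≡ = trans (fb L≡) (p≗q _)

  split-at-maximum : ∀ (L : List (Fin n)) →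
    L ≡ [] ⊎ ∃[ L₁ ] ∃[ M ] ∃[ L₂ ] L ≡ L₁ ++ M ∷ L₂ × All (_≤ M) L
  split-at-maximum []       = inj₁ refl
  split-at-maximum (x ∷ xs) with L₁ , L₂ , eq ← ∈-∃++ ([ here , there ]′ (argmax-sel id x xs)) =
    inj₂ (L₁ , max x xs , L₂ , eq , ⊥≤max x xs ∷ xs≤max x xs)

  below-maximum : ∀ (L₁ : List (Fin n)) {M L₂} → Unique (L₁ ++ M ∷ L₂) →
    All (_≤ M) (L₁ ++ M ∷ L₂) → All (_< M) L₂
  below-maximum L₁ L! L≤M = All.tabulate λ y∈ →
    Fin.≤∧≢⇒< (All.lookup L≤M (∈-++⁺ʳ L₁ (there y∈)))
      λ { refl → unique⇒∉-delete L₁ L! (∈-++⁺ʳ L₁ y∈) }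

  firstBelowMap-deleteMax : ∀ L₁ {M L₂ par} → All (_≤ M) (L₁ ++ M ∷ L₂) →
    FirstBelowMap (L₁ ++ M ∷ L₂) par → FirstBelowMap (L₁ ++ L₂) par
  firstBelowMap-deleteMax L₁ {M} {L₂} {par} L≤M fb {xs} {u} eq with occurrence-in-++ L₁ (sym eq)
  ... | inj₁ (ys′ , refl , refl) = begin
    firstBelow u (ys′ ++ L₂)
      ≡⟨ firstBelow-++ ys′ ⟩
    (firstBelow u ys′ <∣> firstBelow u L₂)
      ≡⟨ cong (firstBelow u ys′ <∣>_) (sym (firstBelow-reject M≮u)) ⟩
    (firstBelow u ys′ <∣> firstBelow u (M ∷ L₂))
      ≡⟨ sym (firstBelow-++ ys′) ⟩
    firstBelow u (ys′ ++ M ∷ L₂)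
      ≡⟨ fb (++-assoc xs (u ∷ ys′) (M ∷ L₂)) ⟩
    par u ∎
    where
    open ≡-Reasoning
    M≮u : ¬ M < u
    M≮u = ℕ.≤⇒≯ (All.lookup L≤M (∈-++⁺ˡ (∈-insert xs)))
  ... | inj₂ (xs′ , refl , refl) = fb (sym (++-assoc L₁ (M ∷ xs′) (u ∷ _)))

  determined-by-firstBelowMap : ∀ {par L L′} → Unique L → Unique L′ → L ⊆ L′ → L′ ⊆ L →
    FirstBelowMap L par → FirstBelowMap L′ par → L ≡ L′
  determined-by-firstBelowMap {par} = go _ refl
    where
    go : ∀ k {L L′} → length L ≡ k → Unique L → Unique L′ → L ⊆ L′ → L′ ⊆ L →
      FirstBelowMap L par → FirstBelowMap L′ par → L ≡ L′
    go k {L} len L! L′! L⊆L′ L′⊆L fb fb′ with split-at-maximum L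
    ... | inj₁ refl = sym (⊆[]⇒≡[] L′⊆L)
    ... | inj₂ (L₁ , M , L₂ , refl , L≤M)
      with L₁′ , L₂′ , refl ← ∈-∃++ (L⊆L′ (∈-insert L₁))
      with k
    ... | zero  with () ← trans (sym (length-++-sucʳ L₁ M L₂)) len
    ... | suc k = cong₂ (λ as bs → as ++ M ∷ bs) (proj₁ halves) (proj₂ halves)
      where
      open ≡-Reasoning
      L′≤M : All (_≤ M) (L₁′ ++ M ∷ L₂′)
      L′≤M = All.tabulate λ x∈ → All.lookup L≤M (L′⊆L x∈)
      deleted : L₁ ++ L₂ ≡ L₁′ ++ L₂′
      deleted = go k (ℕ.suc-injective (trans (sym (length-++-sucʳ L₁ M L₂)) len))
        (unique-delete L₁ L!) (unique-delete L₁′ L′!)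
        (⊆-delete L₁ L! L⊆L′) (⊆-delete L₁′ L′! L′⊆L)
        (firstBelowMap-deleteMax L₁ L≤M fb) (firstBelowMap-deleteMax L₁′ L′≤M fb′)
      heads : head L₂ ≡ head L₂′
      heads = begin
        head L₂          ≡⟨ sym (firstBelow-all (below-maximum L₁ L! L≤M)) ⟩
        firstBelow M L₂  ≡⟨ fb refl ⟩
        par M            ≡⟨ sym (fb′ refl) ⟩
        firstBelow M L₂′ ≡⟨ firstBelow-all (below-maximum L₁′ L′! L′≤M) ⟩
        head L₂′         ∎
      halves = unique-split (unique-delete L₁ L!) deleted heads

-- Postorder traversal of an increasing tree

parentOf : ∀ {m} → ParentFun m → Fin (suc m) → Maybe (Fin (suc m))
parentOf p zero    = nothing
parentOf p (suc k) = just (p k)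

parentOf-cong : ∀ {m} {p q : ParentFun m} → p ≗ᵀ q → parentOf p ≗ parentOf q
parentOf-cong p≗q zero    = refl
parentOf-cong p≗q (suc k) = cong just (p≗q k)

module _ {m} (p : ParentFun m) where

  children-sorted : ∀ v → AllPairs _<_ (children p v)
  children-sorted v = AllPairs.map⁺ (AllPairs.map s≤s (AllPairs.filter⁺ (λ k → p k ≟ v) (allFin-sorted m)))

  children-unique : ∀ v → Unique (children p v)
  children-unique v = AllPairs.map Fin.<⇒≢ (children-sorted v)

  ∈-children⁻ : ∀ {v c} → c ∈ children p v → ∃[ k ] c ≡ suc k × p k ≡ v
  ∈-children⁻ {v} c∈ with k , k∈ , c≡ ← ∈-map⁻ suc c∈ =
    k , c≡ , proj₂ (∈-filter⁻ (λ k → p k ≟ v) {xs = allFin m} k∈)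

  ∈-children⁺ : ∀ {v k} → p k ≡ v → suc k ∈ children p v
  ∈-children⁺ {v} {k} pk≡v = ∈-map⁺ suc (∈-filter⁺ (λ k → p k ≟ v) (∈-allFin k) pk≡v)

module Postorder {m} (T : ParentFun m) (T-inc : IsIncreasing T) where

  child-< : ∀ {v c} → c ∈ children T v → v < c
  child-< c∈ with _ , refl , refl ← ∈-children⁻ T c∈ = s≤s (T-inc _)

  infix 4 _↝_
  data _↝_ : Fin (suc m) → Fin (suc m) → Set where
    ↝-refl : ∀ {x} → x ↝ x
    ↝-step : ∀ {k v} → T k ↝ v → suc k ↝ v

  ↝-trans : ∀ {x y z} → x ↝ y → y ↝ z → x ↝ z
  ↝-trans ↝-refl       y↝z = y↝z
  ↝-trans (↝-step x↝y) y↝z = ↝-step (↝-trans x↝y y↝z)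

  ↝⇒≥ : ∀ {x v} → x ↝ v → v ≤ x
  ↝⇒≥ ↝-refl            = Fin.≤-refl
  ↝⇒≥ (↝-step {k} Tk↝v) = ℕ.≤-trans (↝⇒≥ Tk↝v) (ℕ.m≤n⇒m≤1+n (T-inc k))

  ↝-total : ∀ {x a b} → x ↝ a → x ↝ b → a ↝ b ⊎ b ↝ a
  ↝-total ↝-refl       x↝b          = inj₁ x↝b
  ↝-total x↝a          ↝-refl       = inj₂ x↝a
  ↝-total (↝-step x↝a) (↝-step x↝b) = ↝-total x↝a x↝b

  sibling-↝ : ∀ {v c c′} → c ∈ children T v → c′ ∈ children T v → c ↝ c′ → c ≡ c′
  sibling-↝ _  _   ↝-refl         = refl
  sibling-↝ c∈ c′∈ (↝-step Tk↝c′) with _ , refl , refl ← ∈-children⁻ T c∈ =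
    ⊥-elim (ℕ.≤⇒≯ (↝⇒≥ Tk↝c′) (child-< c′∈))

  ↝-siblings : ∀ {v c c′ y} → c ∈ children T v → c′ ∈ children T v →
    y ↝ c → y ↝ c′ → c ≡ c′
  ↝-siblings c∈ c′∈ y↝c y↝c′ with ↝-total y↝c y↝c′
  ... | inj₁ c↝c′ = sibling-↝ c∈ c′∈ c↝c′
  ... | inj₂ c′↝c = sym (sibling-↝ c′∈ c∈ c′↝c)

  ∈-postorderFrom⇒↝ : ∀ f {v y} → y ∈ postorderFrom T f v → y ↝ v
  ∈-forest⇒↝ : ∀ f cs {y} → y ∈ concatMap (postorderFrom T f) cs → ∃[ c ] c ∈ cs × y ↝ c

  ∈-postorderFrom⇒↝ zero    (here refl) = ↝-refl
  ∈-postorderFrom⇒↝ (suc f) {v} y∈ with ∈-++⁻ (concatMap (postorderFrom T f) (children T v)) y∈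
  ... | inj₂ (here refl) = ↝-refl
  ... | inj₁ y∈forest with c , c∈ , y↝c ← ∈-forest⇒↝ f (children T v) y∈forest
    with _ , refl , refl ← ∈-children⁻ T c∈ = ↝-trans y↝c (↝-step ↝-refl)

  ∈-forest⇒↝ f cs y∈ with c , c∈ , y∈c ← find (∈-concatMap⁻ (postorderFrom T f) {cs} y∈) =
    c , c∈ , ∈-postorderFrom⇒↝ f y∈c

  postorderFrom-unique : ∀ f v → Unique (postorderFrom T f v)
  postorderFrom-unique zero    v = [] ∷ []
  postorderFrom-unique (suc f) v =
    ++⁺ (concatMap-unique (children-unique T v) (λ _ → postorderFrom-unique f _) siblings-disjoint)
      ([] ∷ []) root∉
    where
    siblings-disjoint : ∀ {c c′ y} → c ∈ children T v → c′ ∈ children T v →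
      y ∈ postorderFrom T f c → y ∈ postorderFrom T f c′ → c ≡ c′
    siblings-disjoint c∈ c′∈ y∈c y∈c′ =
      ↝-siblings c∈ c′∈ (∈-postorderFrom⇒↝ f y∈c) (∈-postorderFrom⇒↝ f y∈c′)
    root∉ : ∀ {y} → ¬ (y ∈ concatMap (postorderFrom T f) (children T v) × y ∈ [ v ])
    root∉ (v∈forest , here refl) with c , c∈ , v↝c ← ∈-forest⇒↝ f (children T v) v∈forest =
      ℕ.≤⇒≯ (↝⇒≥ v↝c) (child-< c∈)

  postorderFrom-mono : ∀ f {v y} → y ∈ postorderFrom T f v → y ∈ postorderFrom T (suc f) v
  postorderFrom-mono zero    y∈ = ∈-++⁺ʳ _ y∈
  postorderFrom-mono (suc f) {v} y∈ with ∈-++⁻ (concatMap (postorderFrom T f) (children T v)) y∈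
  ... | inj₁ y∈forest = ∈-++⁺ˡ (∈-concatMap⁺ (postorderFrom T (suc f)) {children T v}
          (Any.map (postorderFrom-mono f) (∈-concatMap⁻ (postorderFrom T f) {children T v} y∈forest)))
  ... | inj₂ y∈v      = ∈-++⁺ʳ _ y∈v

  postorderFrom-mono-≤ : ∀ {f g v y} → f ℕ.≤ g → y ∈ postorderFrom T f v → y ∈ postorderFrom T g v
  postorderFrom-mono-≤ f≤g = go (ℕ.≤⇒≤′ f≤g)
    where
    go : ∀ {f g v y} → f ℕ.≤′ g → y ∈ postorderFrom T f v → y ∈ postorderFrom T g v
    go ℕ.≤′-refl                    y∈ = y∈
    go {g = suc g} (ℕ.≤′-step f≤′g) y∈ = postorderFrom-mono g (go f≤′g y∈)

  ∈-postorderFrom-parent : ∀ f {k y} →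
    y ∈ postorderFrom T f (suc k) → y ∈ postorderFrom T (suc f) (T k)
  ∈-postorderFrom-parent f y∈ =
    ∈-++⁺ˡ (∈-concat⁺′ y∈ (∈-map⁺ (postorderFrom T f) (∈-children⁺ T refl)))

  ∈-postorderFrom-root : ∀ f y → toℕ y ℕ.≤ f → ∀ g {x} →
    x ∈ postorderFrom T g y → x ∈ postorderFrom T (g ℕ.+ f) zero
  ∈-postorderFrom-root f       zero    _         g x∈ = postorderFrom-mono-≤ (ℕ.m≤m+n g f) x∈
  ∈-postorderFrom-root (suc f) (suc k) (s≤s k≤f) g {x} x∈ =
    subst (λ h → x ∈ postorderFrom T h zero) (sym (ℕ.+-suc g f))
      (∈-postorderFrom-root f (T k) (ℕ.≤-trans (T-inc k) k≤f) (suc g) (∈-postorderFrom-parent g x∈))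

  postorder-complete : ∀ y → y ∈ postorder T
  postorder-complete y = ∈-postorderFrom-root m y (Fin.toℕ≤pred[n] y) 1 (∈-++⁺ʳ _ (here refl))

  postorder-unique : Unique (postorder T)
  postorder-unique = postorderFrom-unique (suc m) zero

  next-sibling-parent : ∀ f {v c cs R} → c ∈ children T v → All (c <_) cs →
    firstBelow c (concatMap (postorderFrom T f) cs ++ v ∷ R) ≡ parentOf T c
  next-sibling-parent f {cs = cs} {R} c∈ c<cs with k , refl , refl ← ∈-children⁻ T c∈ = begin
    firstBelow (suc k) (later ++ T k ∷ R)
      ≡⟨ firstBelow-++ later ⟩
    (firstBelow (suc k) later <∣> firstBelow (suc k) (T k ∷ R))
      ≡⟨ cong₂ _<∣>_ (firstBelow-none later≮) (firstBelow-accept (s≤s (T-inc k))) ⟩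
    just (T k) ∎
    where
    open ≡-Reasoning
    later = concatMap (postorderFrom T f) cs
    later≮ : All (λ y → ¬ y < suc k) later
    later≮ = All.tabulate λ y∈ → let (c′ , c′∈ , y↝c′) = ∈-forest⇒↝ f cs y∈ in
      λ y<c → ℕ.<-asym y<c (ℕ.<-≤-trans (All.lookup c<cs c′∈) (↝⇒≥ y↝c′))

  postorderFrom-firstBelow : ∀ f v {R} → firstBelow v R ≡ parentOf T v →
    ∀ {xs u ys} → postorderFrom T f v ≡ xs ++ u ∷ ys → firstBelow u (ys ++ R) ≡ parentOf T u
  forest-firstBelow : ∀ f {v R} cs → AllPairs _<_ cs → cs ⊆ children T v →
    ∀ {xs u ys} → concatMap (postorderFrom T f) cs ≡ xs ++ u ∷ ys →
    firstBelow u (ys ++ v ∷ R) ≡ parentOf T u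

  postorderFrom-firstBelow zero    v R-ok {xs} eq with refl , refl ← singleton-occurrence xs eq = R-ok
  postorderFrom-firstBelow (suc f) v {R} R-ok {u = u} eq
    with occurrence-in-++ (concatMap (postorderFrom T f) (children T v)) (sym eq)
  ... | inj₁ (ys′ , forest≡ , refl) = trans (cong (firstBelow u) (++-assoc ys′ [ v ] R))
                                        (forest-firstBelow f (children T v) (children-sorted T v) id forest≡)
  ... | inj₂ (xs′ , v≡ , refl) with refl , refl ← singleton-occurrence xs′ v≡ = R-ok

  forest-firstBelow f [] _ _ {xs} eq with () ← ++-conicalʳ xs _ (sym eq)
  forest-firstBelow f {v} {R} (c ∷ cs) (c<cs ∷ cs-sorted) cs⊆ {u = u} eq
    with occurrence-in-++ (postorderFrom T f c) (sym eq)
  ... | inj₁ (ys′ , c≡ , refl) =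
    trans (cong (firstBelow u) (++-assoc ys′ (concatMap (postorderFrom T f) cs) (v ∷ R)))
      (postorderFrom-firstBelow f c (next-sibling-parent f (cs⊆ (here refl)) c<cs) c≡)
  ... | inj₂ (xs′ , cs≡ , refl) = forest-firstBelow f cs cs-sorted (cs⊆ ∘ there) cs≡

  postorder-firstBelowMap : FirstBelowMap (postorder T) (parentOf T)
  postorder-firstBelowMap {ys = ys} eq =
    trans (cong (firstBelow _) (sym (++-identityʳ ys))) (postorderFrom-firstBelow (suc m) zero refl eq)

-- First inversions and the word of a permutation

module _ {n} (α : Permutation′ n) where

  firstInversion-≡ : ∀ i →
    firstInversion α i ≡ head (filter (λ j → (i <? j) ×-dec (α ⟨$⟩ʳ j <? α ⟨$⟩ʳ i)) (allFin n))
  firstInversion-≡ i with filter (λ j → (i <? j) ×-dec (α ⟨$⟩ʳ j <? α ⟨$⟩ʳ i)) (allFin n)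
  ... | []    = refl
  ... | _ ∷ _ = refl

  firstInversion-firstBelow : ∀ {ps i qs} → allFin n ≡ ps ++ i ∷ qs → All (_< i) ps → All (i <_) qs →
    Maybe.map (α ⟨$⟩ʳ_) (firstInversion α i) ≡ firstBelow (α ⟨$⟩ʳ i) (map (α ⟨$⟩ʳ_) qs)
  firstInversion-firstBelow {ps} {i} {qs} allFin≡ ps<i i<qs = begin
    Maybe.map f (firstInversion α i)
      ≡⟨ cong (Maybe.map f) (firstInversion-≡ i) ⟩
    Maybe.map f (head (filter inversion? (allFin n)))
      ≡⟨ cong (Maybe.map f ∘ head ∘ filter inversion?) allFin≡ ⟩
    Maybe.map f (head (filter inversion? (ps ++ i ∷ qs)))
      ≡⟨ cong (Maybe.map f ∘ head) inversions-after ⟩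
    Maybe.map f (head (filter (λ j → f j <? f i) qs))
      ≡⟨ head-filter-map f (_<? f i) qs ⟩
    firstBelow (f i) (map f qs) ∎
    where
    open ≡-Reasoning
    f = α ⟨$⟩ʳ_
    inversion? = λ j → (i <? j) ×-dec (f j <? f i)
    inversions-after : filter inversion? (ps ++ i ∷ qs) ≡ filter (λ j → f j <? f i) qs
    inversions-after = begin
      filter inversion? (ps ++ i ∷ qs)
        ≡⟨ filter-++ inversion? ps (i ∷ qs) ⟩
      filter inversion? ps ++ filter inversion? (i ∷ qs)
        ≡⟨ cong₂ _++_ (filter-none inversion? (All.map (λ p<i (i<p , _) → ℕ.<-asym p<i i<p) ps<i))
                      (filter-reject inversion? (λ (i<i , _) → ℕ.<-irrefl refl i<i)) ⟩
      filter inversion? qs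
        ≡⟨ filter-×-dec-All (i <?_) (λ j → f j <? f i) i<qs ⟩
      filter (λ j → f j <? f i) qs ∎

γ-≡ : ∀ {m} (α : Permutation′ (suc m)) k →
  γ α k ≡ maybe′ (α ⟨$⟩ʳ_) zero (firstInversion α (α ⟨$⟩ˡ suc k))
γ-≡ α k with firstInversion α (α ⟨$⟩ˡ suc k)
... | nothing = refl
... | just _  = refl

cyclicPositions : ∀ m → List (Fin (suc m))
cyclicPositions m = tabulate suc ++ [ zero ]

cyclicPositions-unique : ∀ m → Unique (cyclicPositions m)
cyclicPositions-unique m = ++⁺ (tabulate⁺ Fin.suc-injective) ([] ∷ []) λ where
  (0∈ , here refl) → case ∈-tabulate⁻ 0∈ of λ ()

cyclicPositions-complete : ∀ m i → i ∈ cyclicPositions m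
cyclicPositions-complete m zero    = ∈-++⁺ʳ _ (here refl)
cyclicPositions-complete m (suc j) = ∈-++⁺ˡ (∈-tabulate⁺ j)

module _ {m} (α : Permutation′ (suc m)) where

  word : List (Fin (suc m))
  word = map (α ⟨$⟩ʳ_) (cyclicPositions m)

  word-unique : Unique word
  word-unique = map⁺ (⟨$⟩ʳ-injective α) (cyclicPositions-unique m)

  word-complete : ∀ x → x ∈ word
  word-complete x =
    subst (_∈ word) (inverseʳ α) (∈-map⁺ (α ⟨$⟩ʳ_) (cyclicPositions-complete m (α ⟨$⟩ˡ x)))

  take-word : take m word ≡ map (λ k → α ⟨$⟩ʳ suc k) (allFin m)
  take-word = begin
    take m word
      ≡⟨ cong (take m) (map-++ (α ⟨$⟩ʳ_) (tabulate suc) [ zero ]) ⟩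
    take m (map (α ⟨$⟩ʳ_) (tabulate suc) ++ last)
      ≡⟨ cong (λ ws → take m (ws ++ last)) tail≡ ⟩
    take m (tail ++ last)
      ≡⟨ cong (λ k → take k (tail ++ last)) (sym length-tail) ⟩
    take (length tail) (tail ++ last)
      ≡⟨ take-length-++ tail ⟩
    tail ∎
    where
    open ≡-Reasoning
    tail = map (λ k → α ⟨$⟩ʳ suc k) (allFin m)
    last = [ α ⟨$⟩ʳ zero ]
    tail≡ : map (α ⟨$⟩ʳ_) (tabulate suc) ≡ tail
    tail≡ = trans (map-tabulate suc (α ⟨$⟩ʳ_)) (sym (map-tabulate id (λ k → α ⟨$⟩ʳ suc k)))
    length-tail : length tail ≡ m
    length-tail = trans (length-map _ (allFin m)) (length-tabulate id)

module _ {m} (α : Permutation′ (suc m)) (α0 : InS1xS α) where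

  α⁻¹-suc≢0 : ∀ k → α ⟨$⟩ˡ suc k ≢ zero
  α⁻¹-suc≢0 k i≡0 with () ← trans (sym (inverseʳ α)) (trans (cong (α ⟨$⟩ʳ_) i≡0) α0)

  word-split : ∀ ps {i qs} → allFin (suc m) ≡ ps ++ i ∷ qs → i ≢ zero →
    ∃[ xs ] word α ≡ xs ++ (α ⟨$⟩ʳ i) ∷ (map (α ⟨$⟩ʳ_) qs ++ [ zero ])
  word-split []        allFin≡ i≢0 = ⊥-elim (i≢0 (sym (∷-injectiveˡ allFin≡)))
  word-split (_ ∷ ps′) {i} {qs} allFin≡ _ = map f ps′ , (begin
    map f (tabulate suc ++ [ zero ])
      ≡⟨ cong (λ zs → map f (zs ++ [ zero ])) (∷-injectiveʳ allFin≡) ⟩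
    map f ((ps′ ++ i ∷ qs) ++ [ zero ])
      ≡⟨ cong (map f) (++-assoc ps′ (i ∷ qs) [ zero ]) ⟩
    map f (ps′ ++ i ∷ qs ++ [ zero ])
      ≡⟨ map-++ f ps′ (i ∷ qs ++ [ zero ]) ⟩
    map f ps′ ++ f i ∷ map f (qs ++ [ zero ])
      ≡⟨ cong (λ zs → map f ps′ ++ f i ∷ zs) (map-++ f qs [ zero ]) ⟩
    map f ps′ ++ f i ∷ (map f qs ++ [ f zero ])
      ≡⟨ cong (λ z → map f ps′ ++ f i ∷ (map f qs ++ [ z ])) α0 ⟩
    map f ps′ ++ f i ∷ (map f qs ++ [ zero ]) ∎)
    where
    open ≡-Reasoning
    f = α ⟨$⟩ʳ_

  firstBelow-after : ∀ {ps i qs k} → α ⟨$⟩ʳ i ≡ suc k → allFin (suc m) ≡ ps ++ i ∷ qs →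
    All (_< i) ps → All (i <_) qs →
    firstBelow (suc k) (map (α ⟨$⟩ʳ_) qs ++ [ zero ]) ≡
    just (maybe′ (α ⟨$⟩ʳ_) zero (firstInversion α i))
  firstBelow-after {i = i} {qs} {k} fi≡ allFin≡ ps<i i<qs = begin
    firstBelow (suc k) (map f qs ++ [ zero ])
      ≡⟨ firstBelow-++ (map f qs) ⟩
    (firstBelow (suc k) (map f qs) <∣> firstBelow (suc k) [ zero ])
      ≡⟨ cong₂ _<∣>_ inversion (firstBelow-accept {u = suc k} {zero} {[]} (s≤s z≤n)) ⟩
    (Maybe.map f (firstInversion α i) <∣> just zero)
      ≡⟨ maybe′-<∣>-just f zero (firstInversion α i) ⟩
    just (maybe′ f zero (firstInversion α i)) ∎
    where
    open ≡-Reasoning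
    f = α ⟨$⟩ʳ_
    inversion : firstBelow (suc k) (map f qs) ≡ Maybe.map f (firstInversion α i)
    inversion = subst (λ u → firstBelow u (map f qs) ≡ Maybe.map f (firstInversion α i)) fi≡
                  (sym (firstInversion-firstBelow α allFin≡ ps<i i<qs))

  γ-occurrence : ∀ k →
    ∃[ xs ] ∃[ ys ] word α ≡ xs ++ suc k ∷ ys × firstBelow (suc k) ys ≡ just (γ α k)
  γ-occurrence k
    with ps , qs , allFin≡ , ps<i , i<qs ← sorted-split (allFin-sorted (suc m)) (∈-allFin (α ⟨$⟩ˡ suc k))
    with xs , word≡ ← word-split ps allFin≡ (α⁻¹-suc≢0 k) =
    xs , ys , subst (λ u → word α ≡ xs ++ u ∷ ys) (inverseʳ α) word≡ ,
    trans (firstBelow-after (inverseʳ α) allFin≡ ps<i i<qs) (cong just (sym (γ-≡ α k)))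
    where ys = map (α ⟨$⟩ʳ_) qs ++ [ zero ]

  word-firstBelowMap : FirstBelowMap (word α) (parentOf (γ α))
  word-firstBelowMap {u = zero}  {ys} _ = firstBelow-none {ys = ys} (All.tabulate λ _ ())
  word-firstBelowMap {u = suc k} word≡ with xs , ys , word≡′ , firstBelow≡ ← γ-occurrence k =
    subst (λ zs → firstBelow (suc k) zs ≡ just (γ α k)) ys≡ firstBelow≡
    where
    ys≡ = ∷-injectiveʳ (proj₂
      (unique-split (subst Unique word≡′ (word-unique α)) (trans (sym word≡′) word≡) refl))

-- The bijection

γ-increasing : ∀ {m} (α : Permutation′ (suc m)) → InS1xS α → IsIncreasing (γ α)
γ-increasing α α0 k = ℕ.s≤s⁻¹ (firstBelowMap-< (word-firstBelowMap α α0) (word-complete α (suc k)) refl)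

word≡postorder : ∀ {m} (α : Permutation′ (suc m)) → InS1xS α →
  (T : ParentFun m) → IsIncreasing T → γ α ≗ᵀ T → word α ≡ postorder T
word≡postorder α α0 T T-inc γα≗T =
  determined-by-firstBelowMap (word-unique α) postorder-unique
    (λ _ → postorder-complete _) (λ _ → word-complete α _)
    (firstBelowMap-resp (parentOf-cong γα≗T) (word-firstBelowMap α α0)) postorder-firstBelowMap
  where open Postorder T T-inc

γ-injective : ∀ {m} (α β : Permutation′ (suc m)) → InS1xS α → InS1xS β →
  γ α ≗ᵀ γ β → ∀ i → α ⟨$⟩ʳ i ≡ β ⟨$⟩ʳ i
γ-injective {m} α β α0 β0 γα≗γβ i = map-≡⇒∈-≡ words≡ (cyclicPositions-complete m i)
  where
  words≡ : word α ≡ word β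
  words≡ = trans (word≡postorder α α0 (γ β) (γ-increasing β β0) γα≗γβ)
                 (sym (word≡postorder β β0 (γ β) (γ-increasing β β0) λ _ → refl))

γ-surjective : ∀ {m} (T : ParentFun m) → IsIncreasing T →
  Σ (Permutation′ (suc m)) λ α → InS1xS α × γ α ≗ᵀ T
γ-surjective {m} T T-inc = α , α0 , γα≗T
  where
  open Postorder T T-inc
  listing = enumerations⇒permutation (cyclicPositions-unique m) (cyclicPositions-complete m)
              postorder-unique postorder-complete
  α = proj₁ listing
  word≡ : word α ≡ postorder T
  word≡ = proj₂ listing
  α0 : InS1xS α
  α0 = ∷ʳ-injectiveʳ (map (α ⟨$⟩ʳ_) (tabulate suc)) (concatMap (postorderFrom T m) (children T zero))
         (trans (sym (map-++ (α ⟨$⟩ʳ_) (tabulate suc) [ zero ])) word≡)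
  γα≗T : γ α ≗ᵀ T
  γα≗T k = just-injective (firstBelowMap-functional
    (subst (λ L → FirstBelowMap L (parentOf (γ α))) word≡ (word-firstBelowMap α α0))
    postorder-firstBelowMap (postorder-complete (suc k)))

γ⁻¹-postorder : ∀ {m} (T : ParentFun m) → IsIncreasing T → (α : Permutation′ (suc m)) → InS1xS α →
  γ α ≗ᵀ T → map (λ k → α ⟨$⟩ʳ suc k) (allFin m) ≡ take m (postorder T)
γ⁻¹-postorder {m} T T-inc α α0 γα≗T =
  trans (sym (take-word α)) (cong (take m) (word≡postorder α α0 T T-inc γα≗T))

mainTheorem14 : (m : ℕ) →
    -- γ maps S₁ × S_{n-1} into inc(n)
    ((α : Permutation′ (suc m)) → InS1xS α → IsIncreasing (γ α))
    -- γ is injective on S₁ × S_{n-1}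
    × ((α β : Permutation′ (suc m)) → InS1xS α → InS1xS β →
         γ α ≗ᵀ γ β → (i : Fin (suc m)) → α ⟨$⟩ʳ i ≡ β ⟨$⟩ʳ i)
    -- γ is surjective onto inc(n)
    × ((T : ParentFun m) → IsIncreasing T →
         Σ (Permutation′ (suc m)) (λ α → InS1xS α × (γ α ≗ᵀ T)))
    -- description of γ⁻¹(T): α(i) is the (i-1)-th postorder vertex, 2 ≤ i ≤ n
    × ((T : ParentFun m) → IsIncreasing T →
         (α : Permutation′ (suc m)) → InS1xS α → γ α ≗ᵀ T →
         map (λ k → α ⟨$⟩ʳ suc k) (allFin m) ≡ take m (postorder T))
mainTheorem14 m = γ-increasing , γ-injective , γ-surjective , γ⁻¹-postorder
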